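{- Let $G$ be a connected graph and $x\in V(G)$. The closed neighborhood $N[x]$ is a maximal mutual-visibility set of $G$ if and only if for every two vertices $u,v\in N(x)$ we have $uv\in E(G)$ or there exists a vertex $w\in V(G)\setminus N[x]$ which is a common neighbor of $u$ and $v$ in $G$.
   Context: All graphs are simple and undirected. For $X\subseteq V(G)$, two vertices $a,b$ are $X$-visible if there is a shortest $a,b$-path $P$ in $G$ with $V(P)\cap X\subseteq\{a,b\}$. A set $X$ is a mutual-visibility set if every two vertices of $X$ are $X$-visible. A mutual-visibility set $X$ is maximal if no set $Y$ with $X\subsetneq Y$ is a mutual-visibility set. $N(x)$ is the set of neighbors of $x$ and $N[x]=N(x)\cup\{x\}$. -}

module Defs where

open import Data.Nat using (ℕ; zero; suc; _<_)
open import Data.Fin using (Fin)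
open import Data.List using (List; []; _∷_)
open import Data.List.Membership.Propositional using (_∈_)
open import Data.Product using (Σ; ∃; ∃-syntax; _×_; _,_)
open import Data.Sum using (_⊎_)
open import Relation.Nullary using (¬_; Dec)
open import Relation.Binary.PropositionalEquality using (_≡_; _≢_)

record Graph (n : ℕ) : Set₁ where
  field
    E      : Fin n → Fin n → Set
    E-sym  : ∀ {u v} → E u v → E v u
    E-irr  : ∀ {u} → ¬ E u u
    E-dec  : ∀ u v → Dec (E u v)

module _ {n : ℕ} (G : Graph n) where
  open Graph G

  data Walk : Fin n → Fin n → ℕ → Set where
    here : ∀ {a} → Walk a a 0
    step : ∀ {a b c k} → E a b → Walk b c k → Walk a c (suc k)

  verts : ∀ {a b k} → Walk a b k → List (Fin n)
  verts (here {a}) = a ∷ []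
  verts (step {a} _ w) = a ∷ verts w

  -- a shortest a,b-path: a walk of length k with no shorter a,b-walk
  -- (such a walk is necessarily a path)
  IsShortest : ∀ {a b k} → Walk a b k → Set
  IsShortest {a} {b} {k} _ = ∀ {m} → m < k → ¬ Walk a b m

  Connected : Set
  Connected = ∀ a b → ∃[ k ] Walk a b k

  VSet : Set₁
  VSet = Fin n → Set

  Visible : VSet → Fin n → Fin n → Set
  Visible X a b = ∃[ k ] Σ (Walk a b k) λ P → IsShortest P ×
                   (∀ v → v ∈ verts P → X v → v ≡ a ⊎ v ≡ b)

  IsMV : VSet → Set
  IsMV X = ∀ a b → X a → X b → Visible X a b

  IsMaximalMV : VSet → Set₁
  IsMaximalMV X = IsMV X ×
    (∀ (Y : VSet) → (∀ v → X v → Y v) → (∃[ y ] (Y y × ¬ X y)) → ¬ IsMV Y)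

  N : Fin n → VSet
  N x v = E x v

  N[_] : Fin n → VSet
  N[ x ] v = v ≡ x ⊎ E x v

-- N[x] is always maximal once it is a mutual-visibility set: a vertex y outside N[x]
-- cannot see x, because every x,y-walk passes through a neighbour of x, which lies in
-- N[x] and is neither x nor y.  And N[x] is a mutual-visibility set exactly when any two
-- distinct neighbours u, v of x are at distance 1, or at distance 2 via a middle vertex
-- outside N[x]: the path u x v shows d(u,v) ≤ 2, so a shortest u,v-path has at most
-- one inner vertex.
module Submission where

open import Defs
open import Data.Nat using (ℕ; zero; suc; s≤s; z≤n)
open import Data.Fin using (Fin; _≟_)
open import Data.Product using (∃-syntax; _×_; _,_; proj₁)
open import Data.Sum using (_⊎_; inj₁; inj₂)
open import Data.Empty using (⊥-elim)
open import Data.List.Relation.Unary.Any using (here; there)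
open import Data.List.Membership.Propositional using (_∈_)
open import Relation.Nullary using (¬_; yes; no)
open import Relation.Binary.PropositionalEquality using (_≢_; _≡_; refl; sym; subst)
open import Function.Bundles using (_⇔_; mk⇔)

module _ {n : ℕ} (G : Graph n) where
  open Graph G

  walk-0⇒≡ : ∀ {a b} → Walk G a b 0 → a ≡ b
  walk-0⇒≡ here = refl

  walk-1⇒E : ∀ {a b} → Walk G a b 1 → E a b
  walk-1⇒E (step e here) = e

  source∈verts : ∀ {a b k} (P : Walk G a b k) → a ∈ verts G P
  source∈verts here       = here refl
  source∈verts (step _ _) = here refl

  visible-refl : ∀ (X : VSet G) a → Visible G X a a
  visible-refl X a = 0 , here , (λ ()) , λ { _ (here refl) _ → inj₁ refl }

  visible-edge : ∀ (X : VSet G) {a b} → E a b → Visible G X a b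
  visible-edge X {a} {b} e = 1 , step e here , shortest , ends
    where
    shortest : IsShortest G (step e here)
    shortest {zero}  _ P = E-irr (subst (E a) (sym (walk-0⇒≡ P)) e)
    shortest {suc _} (s≤s ())

    ends : ∀ z → z ∈ verts G (step e here) → X z → z ≡ a ⊎ z ≡ b
    ends _ (here refl)         _ = inj₁ refl
    ends _ (there (here refl)) _ = inj₂ refl

  visible-detour : ∀ (X : VSet G) {a b w} → a ≢ b → ¬ E a b → ¬ X w →
    E a w → E w b → Visible G X a b
  visible-detour X {a} {b} a≢b a≁b w∉X e₁ e₂ = 2 , P , shortest , ends
    where
    P : Walk G a b 2
    P = step e₁ (step e₂ here)

    shortest : IsShortest G P
    shortest {zero}        _ Q = a≢b (walk-0⇒≡ Q)
    shortest {suc zero}    _ Q = a≁b (walk-1⇒E Q)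
    shortest {suc (suc _)} (s≤s (s≤s ()))

    ends : ∀ z → z ∈ verts G P → X z → z ≡ a ⊎ z ≡ b
    ends _ (here refl)                 _   = inj₁ refl
    ends _ (there (here refl))         w∈X = ⊥-elim (w∉X w∈X)
    ends _ (there (there (here refl))) _   = inj₂ refl

  module _ (x : Fin n) where

    NeighboursSeeEachOther : Set
    NeighboursSeeEachOther = ∀ u v → u ≢ v → N G x u → N G x v →
      E u v ⊎ (∃[ w ] (¬ N[_] G x w × E u w × E v w))

    ¬visible-outside-N[] : ∀ (Y : VSet G) → (∀ v → N[_] G x v → Y v) →
      ∀ y → ¬ N[_] G x y → ¬ Visible G Y x y
    ¬visible-outside-N[] Y N[x]⊆Y y y∉N[x] (_ , here , _) = y∉N[x] (inj₁ refl)
    ¬visible-outside-N[] Y N[x]⊆Y y y∉N[x] (_ , step {b = b} x~b P , _ , ends)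
      with ends b (there (source∈verts P)) (N[x]⊆Y b (inj₂ x~b))
    ... | inj₁ refl = E-irr x~b
    ... | inj₂ refl = y∉N[x] (inj₂ x~b)

    mv-N[]⇒maximal : IsMV G (N[_] G x) → IsMaximalMV G (N[_] G x)
    mv-N[]⇒maximal mv = mv , λ Y N[x]⊆Y (y , y∈Y , y∉N[x]) mvY →
      ¬visible-outside-N[] Y N[x]⊆Y y y∉N[x] (mvY x y (N[x]⊆Y x (inj₁ refl)) y∈Y)

    shortest-avoiding-N[]⇒seen : ∀ {u v k} → u ≢ v → E x u → E x v →
      (P : Walk G u v k) → IsShortest G P →
      (∀ z → z ∈ verts G P → N[_] G x z → z ≡ u ⊎ z ≡ v) →
      E u v ⊎ (∃[ w ] (¬ N[_] G x w × E u w × E v w))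
    shortest-avoiding-N[]⇒seen u≢v _ _ here _ _ = ⊥-elim (u≢v refl)
    shortest-avoiding-N[]⇒seen _ _ _ (step e here) _ _ = inj₁ e
    shortest-avoiding-N[]⇒seen _ _ _ (step {b = w} e₁ (step e₂ here)) _ ends =
      inj₂ (w , w∉N[x] , e₁ , E-sym e₂)
      where
      w∉N[x] : ¬ N[_] G x w
      w∉N[x] w∈N[x] with ends w (there (here refl)) w∈N[x]
      ... | inj₁ refl = E-irr e₁
      ... | inj₂ refl = E-irr e₂
    shortest-avoiding-N[]⇒seen _ x~u x~v (step _ (step _ (step _ _))) shortest _ =
      ⊥-elim (shortest (s≤s (s≤s (s≤s z≤n))) (step (E-sym x~u) (step x~v here)))

    mv-N[]⇒neighboursSeeEachOther : IsMV G (N[_] G x) → NeighboursSeeEachOther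
    mv-N[]⇒neighboursSeeEachOther mv u v u≢v x~u x~v
      with mv u v (inj₂ x~u) (inj₂ x~v)
    ... | _ , P , shortest , ends =
      shortest-avoiding-N[]⇒seen u≢v x~u x~v P shortest ends

    neighboursSeeEachOther⇒mv-N[] : NeighboursSeeEachOther → IsMV G (N[_] G x)
    neighboursSeeEachOther⇒mv-N[] _ a _ (inj₁ refl) (inj₁ refl) = visible-refl _ a
    neighboursSeeEachOther⇒mv-N[] _ _ _ (inj₁ refl) (inj₂ x~b) = visible-edge _ x~b
    neighboursSeeEachOther⇒mv-N[] _ _ _ (inj₂ x~a) (inj₁ refl) = visible-edge _ (E-sym x~a)
    neighboursSeeEachOther⇒mv-N[] seen a b (inj₂ x~a) (inj₂ x~b) with a ≟ b
    ... | yes refl = visible-refl _ a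
    ... | no a≢b with E-dec a b
    ...   | yes a~b = visible-edge _ a~b
    ...   | no a≁b with seen a b a≢b x~a x~b
    ...     | inj₁ a~b                    = ⊥-elim (a≁b a~b)
    ...     | inj₂ (w , w∉N[x] , a~w , b~w) =
              visible-detour _ a≢b a≁b w∉N[x] a~w (E-sym b~w)

lemma2p1 : ∀ {n} (G : Graph n) → Connected G → (x : Fin n) →
    IsMaximalMV G (N[_] G x) ⇔
      (∀ u v → u ≢ v → N G x u → N G x v →
        Graph.E G u v ⊎
        (∃[ w ] (¬ N[_] G x w × Graph.E G u w × Graph.E G v w)))
lemma2p1 G _ x = mk⇔
  (λ maximal → mv-N[]⇒neighboursSeeEachOther G x (proj₁ maximal))
  (λ seen → mv-N[]⇒maximal G x (neighboursSeeEachOther⇒mv-N[] G x seen))
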